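{- A permutation $w$ is almost vexillary if and only if it avoids the patterns $13254$, $315264$, and $316254$.
   Context: Permutations are in one-line notation; $w$ contains a pattern $p\in S_k$ if some subsequence of $w$ of length $k$ has the same relative order as $p$, and avoids $p$ otherwise. Diagrams are subsets of $[n]\times[n]$, $(i,j)$ in row $i$ (top to bottom) and column $j$. Rothe diagram $D(w)=\{(i,j):i<w^{ -1}(j),\ j<w(i)\}$. A missing tooth of $D$ is $(i,j)\notin D$ with $(i+1,j)\in D$; a column is packed if it has no missing tooth. $D_-(w)$ is obtained from $D(w)$ by deleting all squares lying in packed columns. For a weak composition $\alpha=(\alpha_1,\dots,\alpha_n)$, $D_{\mathrm{Sky}}(\alpha)=\{(i,j):1\le j\le\alpha_i\}$. $w\in S_n$ is almost vexillary if $D_-(w)=\{(i,\sigma(j)):(i,j)\in D_{\mathrm{Sky}}(\alpha)\}$ for some weak composition $\alpha$ and some permutation $\sigma$ of the columns. -}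

module Defs where

open import Data.Nat using (ℕ; suc; _<_; _≤_)
open import Data.Fin using (Fin; toℕ)
open import Data.Vec using (Vec; lookup; []; _∷_)
open import Data.Product using (Σ; ∃; _×_; _,_)
open import Relation.Nullary using (¬_)
open import Relation.Binary.PropositionalEquality using (_≡_)
open import Data.Fin.Permutation using (Permutation′; _⟨$⟩ʳ_; _⟨$⟩ˡ_)
open import Function.Bundles using (_⇔_)

-- Conventions: rows/columns/values indexed 0-based by Fin n
-- (row i of the paper = Fin element with toℕ = i - 1).  A permutation
-- w ∈ S_n is a bijection Fin n ↔ Fin n; w(i) = w ⟨$⟩ʳ i, w⁻¹(j) = w ⟨$⟩ˡ j.

-- Pattern containment.  A pattern p ∈ S_k is given in one-line notation
-- as a vector of naturals (only the relative order of entries matters).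

Contains : ∀ {n k} → Permutation′ n → Vec ℕ k → Set
Contains {n} {k} w p =
  Σ (Fin k → Fin n) λ f →
    (∀ a b → toℕ a < toℕ b → toℕ (f a) < toℕ (f b)) ×
    (∀ a b → (lookup p a < lookup p b) ⇔ (toℕ (w ⟨$⟩ʳ f a) < toℕ (w ⟨$⟩ʳ f b)))

Avoids : ∀ {n k} → Permutation′ n → Vec ℕ k → Set
Avoids w p = ¬ Contains w p

-- Diagrams: subsets of [n]×[n], as predicates on (row, column).

Diagram : ℕ → Set₁
Diagram n = Fin n → Fin n → Set

Rothe : ∀ {n} → Permutation′ n → Diagram n
Rothe w i j = (toℕ i < toℕ (w ⟨$⟩ˡ j)) × (toℕ j < toℕ (w ⟨$⟩ʳ i))

MissingTooth : ∀ {n} → Diagram n → Fin n → Fin n → Set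
MissingTooth D i j = ¬ D i j × Σ _ λ i' → (toℕ i' ≡ suc (toℕ i)) × D i' j

Packed : ∀ {n} → Diagram n → Fin n → Set
Packed D j = ¬ (∃ λ i → MissingTooth D i j)

DMinus : ∀ {n} → Permutation′ n → Diagram n
DMinus w i j = Rothe w i j × ¬ Packed (Rothe w) j

-- Skyline diagram of a weak composition α = (α_1,…,α_n):
-- {(i,j) : 1 ≤ j ≤ α_i}, i.e. 0-based column index toℕ j < α i.
-- (α must have α_i ≤ n for this to be a subset of [n]×[n].)
DSky : ∀ {n} → (Fin n → ℕ) → Diagram n
DSky α i j = toℕ j < α i

_≐_ : ∀ {n} → Diagram n → Diagram n → Set
D ≐ E = ∀ i j → D i j ⇔ E i j

permCols : ∀ {n} → Permutation′ n → Diagram n → Diagram n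
permCols σ D i j = Σ _ λ j' → D i j' × (σ ⟨$⟩ʳ j' ≡ j)

-- w almost vexillary: D_-(w) = σ(D_Sky(α)) for some weak composition α
-- (with parts ≤ n, so that D_Sky(α) ⊆ [n]×[n]) and column permutation σ.
AlmostVexillary : ∀ {n} → Permutation′ n → Set
AlmostVexillary {n} w =
  Σ (Fin n → ℕ) λ α → (∀ i → α i ≤ n) ×
    Σ (Permutation′ n) λ σ → DMinus w ≐ permCols σ (DSky α)

p13254 : Vec ℕ 5
p13254 = 1 ∷ 3 ∷ 2 ∷ 5 ∷ 4 ∷ []

p315264 : Vec ℕ 6
p315264 = 3 ∷ 1 ∷ 5 ∷ 2 ∷ 6 ∷ 4 ∷ []

p316254 : Vec ℕ 6
p316254 = 3 ∷ 1 ∷ 6 ∷ 2 ∷ 5 ∷ 4 ∷ []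

-- Both sides say that the rows of D₋(w) are nested, i.e. that there are no rows i, k and
-- columns a, b with (i,a), (k,b) ∈ D₋(w) but (i,b), (k,a) ∉ D₋(w).
-- A diagram is a column permutation of a skyline exactly when its rows are nested: the rows
-- {j : σ⁻¹ j < α i} of a permuted skyline are nested, and conversely listing the columns by
-- decreasing height makes every row an initial segment.
-- In D(w), such a crossing with i < k forces i, w⁻¹(a), k, w⁻¹(b) to form a 2143, and as column
-- a is not packed it has a missing tooth t, t+1 above w⁻¹(a). Comparing t with i, and w(t+1) with
-- b and w(k), yields 13254, 315264 or 316254. Conversely each of these patterns exhibits two
-- crossing rows of D₋(w), the columns being unpacked because a 132 lies above their dots.
module Submission where

open import Defs
open import Data.Nat using (ℕ; zero; suc; z≤n; s≤s; s≤s⁻¹; _<_; _≤_; _<?_; _≟_)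
open import Data.Nat.Properties
  using (≤-refl; ≤-reflexive; ≤⇒≯; ≤∧≢⇒<; <⇒≤; ≮⇒≥; <-trans; <⇒≢; <-irrefl; <-asym; <-cmp;
         m≤n⇒m<n∨m≡n; m<n⇒m<1+n; 1+n≰n; module ≤-Reasoning)
open import Data.Fin using (Fin; toℕ; #_; fromℕ<; punchOut; combine)
open import Data.Fin.Properties
  using (toℕ-injective; toℕ-fromℕ<; toℕ<n; any?; punchOut-injective; injective⇒≤;
         combine-monoˡ-<; combine-injectiveʳ)
  renaming (_≟_ to _≟ᶠ_; <-cmp to <-cmpᶠ)
open import Data.Fin.Subset using (Subset; _∈_; _⊆_; _⊂_; ∣_∣)
open import Data.Fin.Subset.Properties using (p⊆q⇒∣p∣≤∣q∣; p⊂q⇒∣p∣<∣q∣; ∣p∣≤n; ∣⊤∣≡n; ∈⊤)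
open import Data.Fin.Permutation
  using (Permutation′; permutation; _⟨$⟩ʳ_; _⟨$⟩ˡ_; inverseˡ; inverseʳ)
open import Data.Vec using (Vec; lookup; map; tabulate; []; _∷_)
open import Data.Vec.Properties using (lookup-map; lookup∘tabulate; []=⇒lookup; lookup⇒[]=)
open import Data.Vec.Relation.Unary.Linked using (Linked; [-]; _∷_)
import Data.Vec.Relation.Unary.Linked.Properties as Linked
open import Data.Product using (Σ; ∃; _×_; _,_; proj₁; proj₂)
open import Data.Sum using (_⊎_; inj₁; inj₂; [_,_])
open import Function using (_∘_; _on_)
open import Function.Bundles using (_⇔_; mk⇔; Equivalence; Injection)
open import Function.Construct.Composition using (_⇔-∘_)
open import Function.Construct.Symmetry using (⇔-sym)
open import Function.Definitions using (Injective)
open import Function.Properties.Inverse using (↔⇒↣)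
open import Level using (Level)
open import Relation.Binary using (tri<; tri≈; tri>)
import Relation.Binary.Definitions as B
open import Relation.Binary.PropositionalEquality
  using (_≡_; _≢_; refl; sym; trans; cong; subst; subst₂)
open import Relation.Nullary using (¬_; Dec; yes; no; does; contradiction)
open import Relation.Nullary.Decidable
  using (True; toWitness; _×-dec_; ¬?; dec-true; decidable-stable)
open import Relation.Unary using (Pred; Decidable)

private
  variable
    n : ℕ
    ℓ ℓ′ : Level

subset : {P : Pred (Fin n) ℓ} → Decidable P → Subset n
subset P? = tabulate (λ x → does (P? x))

∈-subset⁺ : {P : Pred (Fin n) ℓ} (P? : Decidable P) → ∀ {x} → P x → x ∈ subset P?
∈-subset⁺ P? {x} Px = lookup⇒[]= x _ (trans (lookup∘tabulate _ x) (dec-true (P? x) Px))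

∈-subset⁻ : {P : Pred (Fin n) ℓ} (P? : Decidable P) → ∀ {x} → x ∈ subset P? → P x
∈-subset⁻ P? {x} x∈ with P? x | trans (sym (lookup∘tabulate _ x)) ([]=⇒lookup x∈)
... | yes Px | _ = Px

subset-⊆ : {P : Pred (Fin n) ℓ} {Q : Pred (Fin n) ℓ′} (P? : Decidable P) (Q? : Decidable Q) →
           (∀ {x} → P x → Q x) → subset P? ⊆ subset Q?
subset-⊆ P? Q? P⇒Q = ∈-subset⁺ Q? ∘ P⇒Q ∘ ∈-subset⁻ P?

subset-⊂ : {P : Pred (Fin n) ℓ} {Q : Pred (Fin n) ℓ′} (P? : Decidable P) (Q? : Decidable Q) →
           (∀ {x} → P x → Q x) → ∀ {x} → Q x → ¬ P x → subset P? ⊂ subset Q?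
subset-⊂ P? Q? P⇒Q {x} Qx ¬Px = subset-⊆ P? Q? P⇒Q , x , ∈-subset⁺ Q? Qx , ¬Px ∘ ∈-subset⁻ P?

∣subset∣<n : {P : Pred (Fin n) ℓ} (P? : Decidable P) → ∀ {x} → ¬ P x → ∣ subset P? ∣ < n
∣subset∣<n {n = n} P? {x} ¬Px =
  subst (∣ subset P? ∣ <_) (∣⊤∣≡n n) (p⊂q⇒∣p∣<∣q∣ ((λ _ → ∈⊤) , x , ∈⊤ , ¬Px ∘ ∈-subset⁻ P?))

injective⇒surjective : {f : Fin n → Fin n} → Injective _≡_ _≡_ f → ∀ y → ∃ λ x → f x ≡ y
injective⇒surjective {suc m} {f} f-injective y with any? (λ x → f x ≟ᶠ y)
... | yes hit = hit
... | no miss = contradiction (injective⇒≤ g-injective) 1+n≰n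
  where
  f≢y : ∀ x → y ≢ f x
  f≢y x y≡fx = miss (x , sym y≡fx)
  g : Fin (suc m) → Fin m
  g x = punchOut (f≢y x)
  g-injective : Injective _≡_ _≡_ g
  g-injective eq = f-injective (punchOut-injective (f≢y _) (f≢y _) eq)

module Ranking {n : ℕ} (key : Fin n → ℕ) (key-injective : Injective _≡_ _≡_ key) where

  rank : Fin n → ℕ
  rank c = ∣ subset (λ c′ → key c <? key c′) ∣

  rank<n : ∀ c → rank c < n
  rank<n c = ∣subset∣<n (λ c′ → key c <? key c′) (<-irrefl refl)

  rank-antitone : ∀ {c c′} → key c < key c′ → rank c′ < rank c
  rank-antitone {c} {c′} c<c′ = p⊂q⇒∣p∣<∣q∣
    (subset-⊂ (λ x → key c′ <? key x) (λ x → key c <? key x) (<-trans c<c′) c<c′ (<-irrefl refl))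

  rank-injective : Injective _≡_ _≡_ rank
  rank-injective {c} {c′} eq with <-cmp (key c) (key c′)
  ... | tri< c<c′ _ _ = contradiction (sym eq) (<⇒≢ (rank-antitone c<c′))
  ... | tri≈ _ c≡c′ _ = key-injective c≡c′
  ... | tri> _ _ c′<c = contradiction eq (<⇒≢ (rank-antitone c′<c))

  rankᶠ : Fin n → Fin n
  rankᶠ c = fromℕ< (rank<n c)

  rankᶠ-injective : Injective _≡_ _≡_ rankᶠ
  rankᶠ-injective eq =
    rank-injective (trans (sym (toℕ-fromℕ< _)) (trans (cong toℕ eq) (toℕ-fromℕ< _)))

  byRank : Permutation′ n
  byRank = permutation select rankᶠ (λ c → rankᶠ-injective (rankᶠ-select (rankᶠ c))) rankᶠ-select
    where
    select : Fin n → Fin n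
    select r = proj₁ (injective⇒surjective rankᶠ-injective r)
    rankᶠ-select : ∀ r → rankᶠ (select r) ≡ r
    rankᶠ-select r = proj₂ (injective⇒surjective rankᶠ-injective r)

  toℕ-byRankˡ : ∀ c → toℕ (byRank ⟨$⟩ˡ c) ≡ rank c
  toℕ-byRankˡ c = toℕ-fromℕ< (rank<n c)

step-between : {P : Pred ℕ ℓ} → Decidable P → ∀ {m n} → m ≤ n → ¬ P m → P n →
               ∃ λ k → k < n × ¬ P k × P (suc k)
step-between P? {n = zero} z≤n ¬Pm Pn = contradiction Pn ¬Pm
step-between P? {m} {suc n} m≤1+n ¬Pm P1+n with m≤n⇒m<n∨m≡n m≤1+n | P? n
... | inj₂ refl      | _      = contradiction P1+n ¬Pm
... | inj₁ _         | no ¬Pn = n , ≤-refl , ¬Pn , P1+n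
... | inj₁ (s≤s m≤n) | yes Pn with k , k<n , ¬Pk , P1+k ← step-between P? m≤n ¬Pm Pn
  = k , m<n⇒m<1+n k<n , ¬Pk , P1+k

lookup-<⇔ : ∀ {A : Set ℓ} {k} {g : A → ℕ} {ys : Vec A k} → Linked (_<_ on g) ys →
            ∀ i j → toℕ i < toℕ j ⇔ g (lookup ys i) < g (lookup ys j)
lookup-<⇔ ys↑ i j = mk⇔ (Linked.lookup⁺ <-trans ys↑) reflect
  where
  reflect : _ → toℕ i < toℕ j
  reflect g< with <-cmpᶠ i j
  ... | tri< i<j _ _ = i<j
  ... | tri≈ _ refl _ = contradiction g< (<-irrefl refl)
  ... | tri> _ _ j<i = contradiction g< (<-asym (Linked.lookup⁺ <-trans ys↑ j<i))

Crossing : Diagram n → Fin n → Fin n → Fin n → Fin n → Set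
Crossing D i k a b = D i a × ¬ D i b × D k b × ¬ D k a

Crossing-swap : ∀ {D : Diagram n} {i k a b} → Crossing D i k a b → Crossing D k i b a
Crossing-swap (Dia , ¬Dib , Dkb , ¬Dka) = Dkb , ¬Dka , Dia , ¬Dib

RowsNested : Diagram n → Set
RowsNested D = ∀ i k a b → ¬ Crossing D i k a b

-- AlmostVexillary w unfolds to PermutedSkyline (DMinus w).
PermutedSkyline : Diagram n → Set
PermutedSkyline {n} D =
  Σ (Fin n → ℕ) λ α → (∀ i → α i ≤ n) × Σ (Permutation′ n) λ σ → D ≐ permCols σ (DSky α)

permCols-DSky : ∀ (σ : Permutation′ n) α i j → permCols σ (DSky α) i j ⇔ toℕ (σ ⟨$⟩ˡ j) < α i
permCols-DSky σ α i j = mk⇔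
  (λ (j′ , j′<αi , σj′≡j) →
     subst (λ x → toℕ x < α i) (trans (sym (inverseˡ σ)) (cong (σ ⟨$⟩ˡ_) σj′≡j)) j′<αi)
  (λ σ⁻¹j<αi → σ ⟨$⟩ˡ j , σ⁻¹j<αi , inverseʳ σ)

permutedSkyline⇒rowsNested : {D : Diagram n} → PermutedSkyline D → RowsNested D
permutedSkyline⇒rowsNested {D = D} (α , _ , σ , D≐) i k a b (Dia , ¬Dib , Dkb , ¬Dka) =
  <-irrefl refl (begin-strict
    r a  <⟨ inRow Dia ⟩
    α i  ≤⟨ outOfRow ¬Dib ⟩
    r b  <⟨ inRow Dkb ⟩
    α k  ≤⟨ outOfRow ¬Dka ⟩
    r a  ∎)
  where
  open ≤-Reasoning
  r : Fin _ → ℕ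
  r j = toℕ (σ ⟨$⟩ˡ j)
  inRow : ∀ {i j} → D i j → r j < α i
  inRow {i} {j} = Equivalence.to (permCols-DSky σ α i j) ∘ Equivalence.to (D≐ i j)
  outOfRow : ∀ {i j} → ¬ D i j → α i ≤ r j
  outOfRow {i} {j} ¬Dij =
    ≮⇒≥ (¬Dij ∘ Equivalence.from (D≐ i j) ∘ Equivalence.from (permCols-DSky σ α i j))

-- With nested rows every column of row i is taller than every column missing from it (height-<),
-- so row i consists of its α i tallest columns; key orders columns by height, ties broken by index.
module ColumnsByHeight {n : ℕ} {D : Diagram n} (D? : B.Decidable D) (nested : RowsNested D) where

  row column : Fin n → Subset n
  row i = subset (D? i)
  column c = subset (λ i → D? i c)

  height : Fin n → ℕ
  height c = ∣ column c ∣

  height-< : ∀ {i j c} → D i j → ¬ D i c → height c < height j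
  height-< {i} {j} {c} Dij ¬Dic = p⊂q⇒∣p∣<∣q∣ (subset-⊂ (λ k → D? k c) (λ k → D? k j) Dkc⇒Dkj Dij ¬Dic)
    where
    Dkc⇒Dkj : ∀ {k} → D k c → D k j
    Dkc⇒Dkj {k} Dkc = decidable-stable (D? k j) (λ ¬Dkj → nested i k j c (Dij , ¬Dic , Dkc , ¬Dkj))

  heightᶠ : Fin n → Fin (suc n)
  heightᶠ c = fromℕ< (s≤s (∣p∣≤n (column c)))

  key : Fin n → ℕ
  key c = toℕ (combine (heightᶠ c) c)

  key-injective : Injective _≡_ _≡_ key
  key-injective {c} {c′} eq = combine-injectiveʳ (heightᶠ c) c (heightᶠ c′) c′ (toℕ-injective eq)

  key-monotone : ∀ {c c′} → height c < height c′ → key c < key c′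
  key-monotone {c} {c′} h<h′ =
    combine-monoˡ-< c c′ (subst₂ _<_ (sym (toℕ-fromℕ< _)) (sym (toℕ-fromℕ< _)) h<h′)

  open Ranking key key-injective public

  α : Fin n → ℕ
  α i = ∣ row i ∣

  inRow : ∀ {i j} → D i j → rank j < α i
  inRow {i} {j} Dij = p⊂q⇒∣p∣<∣q∣ (subset-⊂ (λ c → key j <? key c) (D? i) above⇒Dic Dij (<-irrefl refl))
    where
    above⇒Dic : ∀ {c} → key j < key c → D i c
    above⇒Dic {c} j<c =
      decidable-stable (D? i c) (λ ¬Dic → <-asym j<c (key-monotone (height-< Dij ¬Dic)))

  outOfRow : ∀ {i j} → ¬ D i j → α i ≤ rank j
  outOfRow {i} {j} ¬Dij = p⊆q⇒∣p∣≤∣q∣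
    (subset-⊆ (D? i) (λ c → key j <? key c) (λ Dic → key-monotone (height-< Dic ¬Dij)))

  D⇔rank<α : ∀ i j → D i j ⇔ rank j < α i
  D⇔rank<α i j =
    mk⇔ inRow (λ j<αi → decidable-stable (D? i j) (λ ¬Dij → ≤⇒≯ (outOfRow ¬Dij) j<αi))

  D≐ : D ≐ permCols byRank (DSky α)
  D≐ i j = ⇔-sym (permCols-DSky byRank α i j)
       ⇔-∘ subst (λ r → D i j ⇔ r < α i) (sym (toℕ-byRankˡ j)) (D⇔rank<α i j)

rowsNested⇒permutedSkyline : {D : Diagram n} → B.Decidable D → RowsNested D → PermutedSkyline D
rowsNested⇒permutedSkyline D? nested = α , (λ i → ∣p∣≤n (row i)) , byRank , D≐
  where open ColumnsByHeight D? nested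

permutedSkyline⇔rowsNested : {D : Diagram n} → B.Decidable D → PermutedSkyline D ⇔ RowsNested D
permutedSkyline⇔rowsNested D? = mk⇔ permutedSkyline⇒rowsNested (rowsNested⇒permutedSkyline D?)

missingTooth-between : {D : Diagram n} → B.Decidable D → ∀ {p q c} →
                       toℕ p < toℕ q → ¬ D p c → D q c → ∃ λ t → MissingTooth D t c
missingTooth-between {n} {D} D? {p} {q} {c} p<q ¬Dpc Dqc =
  tooth (step-between R? (<⇒≤ p<q) ¬Rp (q , refl , Dqc))
  where
  R : Pred ℕ _
  R m = ∃ λ i → toℕ i ≡ m × D i c
  R? : Decidable R
  R? m = any? (λ i → (toℕ i ≟ m) ×-dec D? i c)
  ¬Rp : ¬ R (toℕ p)
  ¬Rp (i , i≡p , Dic) = ¬Dpc (subst (λ x → D x c) (toℕ-injective i≡p) Dic)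
  tooth : (∃ λ k → k < toℕ q × ¬ R k × R (suc k)) → ∃ λ t → MissingTooth D t c
  tooth (k , k<q , ¬Rk , t′ , t′≡1+k , Dt′c) =
    t , (λ Dtc → ¬Rk (t , toℕ-fromℕ< _ , Dtc)) ,
    t′ , trans t′≡1+k (cong suc (sym (toℕ-fromℕ< _))) , Dt′c
    where
    t : Fin n
    t = fromℕ< (<-trans k<q (toℕ<n q))

Packed? : {D : Diagram n} → B.Decidable D → ∀ c → Dec (Packed D c)
Packed? D? c =
  ¬? (any? λ i → ¬? (D? i c) ×-dec any? (λ i′ → (toℕ i′ ≟ suc (toℕ i)) ×-dec D? i′ c))

module _ {n : ℕ} (w : Permutation′ n) where

  W : Fin n → ℕ
  W x = toℕ (w ⟨$⟩ʳ x)

  W-injective : ∀ {x y} → W x ≡ W y → x ≡ y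
  W-injective = Injection.injective (↔⇒↣ w) ∘ toℕ-injective

  Rothe? : B.Decidable (Rothe w)
  Rothe? i j = (toℕ i <? toℕ (w ⟨$⟩ˡ j)) ×-dec (toℕ j <? W i)

  DMinus? : B.Decidable (DMinus w)
  DMinus? i j = Rothe? i j ×-dec ¬? (Packed? Rothe? j)

  Rothe-at : ∀ {i x} → Rothe w i (w ⟨$⟩ʳ x) ⇔ (toℕ i < toℕ x × W x < W i)
  Rothe-at {i} = mk⇔ (λ (i< , <Wi) → subst (λ y → toℕ i < toℕ y) (inverseˡ w) i< , <Wi)
                     (λ (i< , <Wi) → subst (λ y → toℕ i < toℕ y) (sym (inverseˡ w)) i< , <Wi)

  ∈Rothe : ∀ {i x} → toℕ i < toℕ x → W x < W i → Rothe w i (w ⟨$⟩ʳ x)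
  ∈Rothe i<x Wx<Wi = Equivalence.from Rothe-at (i<x , Wx<Wi)

  ∉Rothe-rightOfDot : ∀ {i x} → W i < W x → ¬ Rothe w i (w ⟨$⟩ʳ x)
  ∉Rothe-rightOfDot Wi<Wx (_ , Wx<Wi) = <-asym Wi<Wx Wx<Wi

  ∉Rothe-belowDot : ∀ {i x} → toℕ x < toℕ i → ¬ Rothe w i (w ⟨$⟩ʳ x)
  ∉Rothe-belowDot x<i Rix = <-asym x<i (proj₁ (Equivalence.to Rothe-at Rix))

  ∉Rothe⇒rightOfDot : ∀ {i x} → ¬ Rothe w i (w ⟨$⟩ʳ x) → toℕ i < toℕ x → W i < W x
  ∉Rothe⇒rightOfDot ∉R i<x =
    ≤∧≢⇒< (≮⇒≥ (λ Wx<Wi → ∉R (∈Rothe i<x Wx<Wi))) (<⇒≢ i<x ∘ cong toℕ ∘ W-injective)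

  ∉Rothe⇒belowDot : ∀ {i x} → ¬ Rothe w i (w ⟨$⟩ʳ x) → W x < W i → toℕ x < toℕ i
  ∉Rothe⇒belowDot ∉R Wx<Wi =
    ≤∧≢⇒< (≮⇒≥ (λ i<x → ∉R (∈Rothe i<x Wx<Wi))) (<⇒≢ Wx<Wi ∘ cong W ∘ toℕ-injective)

  132⇒¬Packed : ∀ {p q x} → toℕ p < toℕ q → toℕ q < toℕ x → W p < W x → W x < W q →
                ¬ Packed (Rothe w) (w ⟨$⟩ʳ x)
  132⇒¬Packed p<q q<x Wp<Wx Wx<Wq packed =
    packed (missingTooth-between Rothe? p<q (∉Rothe-rightOfDot Wp<Wx) (∈Rothe q<x Wx<Wq))

  -- ys lists the entries of the occurrence by increasing value, and π a is the value rank of the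
  -- a-th entry in position order.
  occurrence : ∀ {k} {p : Vec ℕ k} (π : Vec (Fin k) k) (ys : Vec (Fin n) k) →
               p ≡ map (suc ∘ toℕ) π → Linked (_<_ on toℕ) (map (lookup ys) π) →
               Linked (_<_ on W) ys → Contains w p
  occurrence π ys refl xs↑ ys↑ =
    lookup (map (lookup ys) π) , (λ _ _ → Linked.lookup⁺ <-trans xs↑) , sameOrder
    where
    sameOrder : ∀ a b → lookup (map (suc ∘ toℕ) π) a < lookup (map (suc ∘ toℕ) π) b ⇔
                        W (lookup (map (lookup ys) π) a) < W (lookup (map (lookup ys) π) b)
    sameOrder a b rewrite lookup-map a (suc ∘ toℕ) π | lookup-map b (suc ∘ toℕ) π
                        | lookup-map a (lookup ys) π | lookup-map b (lookup ys) π =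
      lookup-<⇔ ys↑ (lookup π a) (lookup π b) ⇔-∘ mk⇔ s≤s⁻¹ s≤s

  crossing⇒2143 : ∀ {i k x y} → toℕ i < toℕ k → Crossing (Rothe w) i k (w ⟨$⟩ʳ x) (w ⟨$⟩ʳ y) →
                  (toℕ i < toℕ x × toℕ x < toℕ k × toℕ k < toℕ y) × (W x < W i × W i < W y × W y < W k)
  crossing⇒2143 i<k (Rix , ¬Riy , Rky , ¬Rkx)
    with i<x , Wx<Wi ← Equivalence.to Rothe-at Rix
       | k<y , Wy<Wk ← Equivalence.to Rothe-at Rky
    with Wi<Wy ← ∉Rothe⇒rightOfDot ¬Riy (<-trans i<k k<y)
    = (i<x , ∉Rothe⇒belowDot ¬Rkx (<-trans Wx<Wi (<-trans Wi<Wy Wy<Wk)) , k<y) , (Wx<Wi , Wi<Wy , Wy<Wk)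

  crossing⇒pattern : ∀ {i k x y t} → toℕ i < toℕ k →
                     Crossing (Rothe w) i k (w ⟨$⟩ʳ x) (w ⟨$⟩ʳ y) →
                     MissingTooth (Rothe w) t (w ⟨$⟩ʳ x) →
                     Contains w p13254 ⊎ Contains w p315264 ⊎ Contains w p316254
  crossing⇒pattern {i} {k} {x} {y} {t} i<k crossing (¬Rtx , t′ , t′≡1+t , Rt′x)
    with (i<x , x<k , k<y) , (Wx<Wi , Wi<Wy , Wy<Wk) ← crossing⇒2143 i<k crossing
    with t′<x , Wx<Wt′ ← Equivalence.to Rothe-at Rt′x
    with t<t′ ← ≤-reflexive (sym t′≡1+t)
    with Wt<Wx ← ∉Rothe⇒rightOfDot ¬Rtx (<-trans t<t′ t′<x)
    with <-cmp (toℕ t) (toℕ i)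
  ... | tri< t<i _ _ = inj₁
    (occurrence (# 0 ∷ # 2 ∷ # 1 ∷ # 4 ∷ # 3 ∷ []) (t ∷ x ∷ i ∷ y ∷ k ∷ []) refl
                (t<i ∷ i<x ∷ x<k ∷ k<y ∷ [-]) (Wt<Wx ∷ Wx<Wi ∷ Wi<Wy ∷ Wy<Wk ∷ [-]))
  ... | tri≈ _ t≡i _ = contradiction (<-trans Wt<Wx Wx<Wi) (<-irrefl (cong W (toℕ-injective t≡i)))
  ... | tri> _ _ i<t with <-cmp (W t′) (W y)
  ...   | tri< Wt′<Wy _ _ = inj₁
    (occurrence (# 0 ∷ # 2 ∷ # 1 ∷ # 4 ∷ # 3 ∷ []) (t ∷ x ∷ t′ ∷ y ∷ k ∷ []) refl
                (t<t′ ∷ t′<x ∷ x<k ∷ k<y ∷ [-]) (Wt<Wx ∷ Wx<Wt′ ∷ Wt′<Wy ∷ Wy<Wk ∷ [-]))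
  ...   | tri≈ _ Wt′≡Wy _ =
    contradiction (cong toℕ (W-injective Wt′≡Wy)) (<⇒≢ (<-trans t′<x (<-trans x<k k<y)))
  ...   | tri> _ _ Wy<Wt′ with <-cmp (W t′) (W k)
  ...     | tri< Wt′<Wk _ _ = inj₂ (inj₁
    (occurrence (# 2 ∷ # 0 ∷ # 4 ∷ # 1 ∷ # 5 ∷ # 3 ∷ []) (t ∷ x ∷ i ∷ y ∷ t′ ∷ k ∷ []) refl
                (i<t ∷ t<t′ ∷ t′<x ∷ x<k ∷ k<y ∷ [-]) (Wt<Wx ∷ Wx<Wi ∷ Wi<Wy ∷ Wy<Wt′ ∷ Wt′<Wk ∷ [-])))
  ...     | tri≈ _ Wt′≡Wk _ = contradiction (cong toℕ (W-injective Wt′≡Wk)) (<⇒≢ (<-trans t′<x x<k))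
  ...     | tri> _ _ Wk<Wt′ = inj₂ (inj₂
    (occurrence (# 2 ∷ # 0 ∷ # 5 ∷ # 1 ∷ # 4 ∷ # 3 ∷ []) (t ∷ x ∷ i ∷ y ∷ k ∷ t′ ∷ []) refl
                (i<t ∷ t<t′ ∷ t′<x ∷ x<k ∷ k<y ∷ [-]) (Wt<Wx ∷ Wx<Wi ∷ Wi<Wy ∷ Wy<Wk ∷ Wk<Wt′ ∷ [-])))

  -- The missing tooth is only available under a double negation, as ¬ Packed.
  DMinus-crossing⇒pattern : ∀ {i k a b} → toℕ i < toℕ k → Crossing (DMinus w) i k a b →
                            ¬ ¬ (Contains w p13254 ⊎ Contains w p315264 ⊎ Contains w p316254)
  DMinus-crossing⇒pattern {i} {k} {a} {b} i<k
    ((Ria , a-unpacked) , ¬D-ib , (Rkb , b-unpacked) , ¬D-ka) noPattern =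
    a-unpacked λ (t , tooth) → noPattern (crossing⇒pattern i<k
      (subst₂ (Crossing (Rothe w) i k) (sym (inverseʳ w)) (sym (inverseʳ w)) rotheCrossing)
      (subst (MissingTooth (Rothe w) t) (sym (inverseʳ w)) tooth))
    where
    rotheCrossing : Crossing (Rothe w) i k a b
    rotheCrossing = Ria , (λ Rib → ¬D-ib (Rib , b-unpacked)) , Rkb , (λ Rka → ¬D-ka (Rka , a-unpacked))

  avoiding⇒rowsNested : Avoids w p13254 → Avoids w p315264 → Avoids w p316254 →
                        RowsNested (DMinus w)
  avoiding⇒rowsNested av₁ av₂ av₃ i k a b crossing with <-cmp (toℕ i) (toℕ k)
  ... | tri< i<k _ _ = DMinus-crossing⇒pattern i<k crossing [ av₁ , [ av₂ , av₃ ] ]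
  ... | tri> _ _ k<i =
    DMinus-crossing⇒pattern k<i (Crossing-swap {D = DMinus w} crossing) [ av₁ , [ av₂ , av₃ ] ]
  ... | tri≈ _ i≡k _ with refl ← toℕ-injective i≡k = proj₂ (proj₂ (proj₂ crossing)) (proj₁ crossing)

  module Occurrence {k} (p : Vec ℕ k) (occ : Contains w p) where

    at : Fin k → Fin n
    at = proj₁ occ

    pos< : ∀ a b {a<b : True (toℕ a <? toℕ b)} → toℕ (at a) < toℕ (at b)
    pos< a b {a<b} = proj₁ (proj₂ occ) a b (toWitness a<b)

    val< : ∀ a b {pa<pb : True (lookup p a <? lookup p b)} → W (at a) < W (at b)
    val< a b {pa<pb} = Equivalence.to (proj₂ (proj₂ occ) a b) (toWitness pa<pb)

  13254⇒¬rowsNested : Contains w p13254 → ¬ RowsNested (DMinus w)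
  13254⇒¬rowsNested occ nested = nested (at (# 1)) (at (# 3)) (w ⟨$⟩ʳ at (# 2)) (w ⟨$⟩ʳ at (# 4))
    ( ( ∈Rothe (pos< (# 1) (# 2)) (val< (# 2) (# 1))
      , 132⇒¬Packed (pos< (# 0) (# 1)) (pos< (# 1) (# 2)) (val< (# 0) (# 2)) (val< (# 2) (# 1)))
    , ∉Rothe-rightOfDot (val< (# 1) (# 4)) ∘ proj₁
    , ( ∈Rothe (pos< (# 3) (# 4)) (val< (# 4) (# 3))
      , 132⇒¬Packed (pos< (# 0) (# 3)) (pos< (# 3) (# 4)) (val< (# 0) (# 4)) (val< (# 4) (# 3)))
    , ∉Rothe-belowDot (pos< (# 2) (# 3)) ∘ proj₁ )
    where open Occurrence p13254 occ

  -- 315264 and 316254 give the same crossing: the order of their entries 5 and 6 is never used.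
  315264⇒¬rowsNested : Contains w p315264 → ¬ RowsNested (DMinus w)
  315264⇒¬rowsNested occ nested = nested (at (# 0)) (at (# 4)) (w ⟨$⟩ʳ at (# 3)) (w ⟨$⟩ʳ at (# 5))
    ( ( ∈Rothe (pos< (# 0) (# 3)) (val< (# 3) (# 0))
      , 132⇒¬Packed (pos< (# 1) (# 2)) (pos< (# 2) (# 3)) (val< (# 1) (# 3)) (val< (# 3) (# 2)))
    , ∉Rothe-rightOfDot (val< (# 0) (# 5)) ∘ proj₁
    , ( ∈Rothe (pos< (# 4) (# 5)) (val< (# 5) (# 4))
      , 132⇒¬Packed (pos< (# 0) (# 4)) (pos< (# 4) (# 5)) (val< (# 0) (# 5)) (val< (# 5) (# 4)))
    , ∉Rothe-belowDot (pos< (# 3) (# 4)) ∘ proj₁ )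
    where open Occurrence p315264 occ

  316254⇒¬rowsNested : Contains w p316254 → ¬ RowsNested (DMinus w)
  316254⇒¬rowsNested occ nested = nested (at (# 0)) (at (# 4)) (w ⟨$⟩ʳ at (# 3)) (w ⟨$⟩ʳ at (# 5))
    ( ( ∈Rothe (pos< (# 0) (# 3)) (val< (# 3) (# 0))
      , 132⇒¬Packed (pos< (# 1) (# 2)) (pos< (# 2) (# 3)) (val< (# 1) (# 3)) (val< (# 3) (# 2)))
    , ∉Rothe-rightOfDot (val< (# 0) (# 5)) ∘ proj₁
    , ( ∈Rothe (pos< (# 4) (# 5)) (val< (# 5) (# 4))
      , 132⇒¬Packed (pos< (# 0) (# 4)) (pos< (# 4) (# 5)) (val< (# 0) (# 5)) (val< (# 5) (# 4)))
    , ∉Rothe-belowDot (pos< (# 3) (# 4)) ∘ proj₁ )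
    where open Occurrence p316254 occ

  rowsNested⇔avoiding : RowsNested (DMinus w) ⇔ (Avoids w p13254 × Avoids w p315264 × Avoids w p316254)
  rowsNested⇔avoiding = mk⇔
    (λ nested → (λ occ → 13254⇒¬rowsNested occ nested)
              , (λ occ → 315264⇒¬rowsNested occ nested)
              , (λ occ → 316254⇒¬rowsNested occ nested))
    (λ (av₁ , av₂ , av₃) → avoiding⇒rowsNested av₁ av₂ av₃)

theorem5p1 : (n : ℕ) (w : Permutation′ n) →
    AlmostVexillary w ⇔ (Avoids w p13254 × Avoids w p315264 × Avoids w p316254)
theorem5p1 n w = rowsNested⇔avoiding w ⇔-∘ permutedSkyline⇔rowsNested (DMinus? w)
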